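{- Let $m\ge 3$, $n\ge 2$ and $2\le l\le\lceil n/2\rceil$. For every positive integer $k$, $$\chi^b_{B_l^*(m,n)}(2k)=\Big[\sum_{i=0}^{m-2}(-1)^i(2k-1)^{(m-2)-i}\Big]\,\chi^b_{B_{l-1}^*(m,n-1)}(2k).$$
   Context: A signed graph $(G,\sigma)$ is a finite graph $G$ with a sign function $\sigma:E(G)\to\{+1,-1\}$; its signature is the set of negative edges. A zero-free signed coloring in $2k$ colors is a map $c:V(G)\to\{ -k,\dots,-1,1,\dots,k\}$; it is proper if $c(y)\neq\sigma(e)c(x)$ for every edge $e=xy$. The balanced chromatic polynomial $\chi^b_{(G,\sigma)}(2k)$ is the number of proper zero-free signed colorings in $2k$ colors. For integers $m\ge 3$, $n\ge 1$, the Book graph $B(m,n)$ has vertex set $\{u,v\}\cup\{u_j^l:1\le l\le n,\,1\le j\le m-2\}$ and consists of the $n$ cycles $u\,u_1^l\cdots u_{m-2}^l\,v\,u$ sharing the edge $uv$. For $1\le l\le n$, $B_l^*(m,n)$ denotes $B(m,n)$ with signature $\{uv,uu_1^1,\dots,uu_1^{l-1}\}$. -}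

module Defs where

open import Data.Nat as ℕ using (ℕ; zero; suc; _∸_; _<_; _<ᵇ_)
open import Data.Bool using (Bool; true; false; if_then_else_)
open import Data.Fin as Fin using (Fin; zero; suc; toℕ; inject₁; fromℕ; combine)
open import Data.Integer as ℤ using (ℤ; +_; -[1+_]; -_)
open import Data.List using (List; []; _∷_; _++_; map; concatMap; length; filter; upTo; allFin; foldr)
open import Data.List.Relation.Unary.All using (All; all?)
open import Data.Vec using (Vec; []; _∷_; lookup)
open import Data.Product using (_×_; _,_)
open import Relation.Binary.PropositionalEquality using (_≡_)
open import Relation.Nullary using (¬_; ¬?)

data Sign : Set where
  pos neg : Sign

act : Sign → ℤ → ℤ
act pos x = x
act neg x = - x

record SignedGraph : Set where
  constructor mkSG
  field
    N     : ℕ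
    edges : List (Fin N × Fin N × Sign)
open SignedGraph public

colors : ℕ → List ℤ
colors k = map -[1+_] (upTo k) ++ map (λ i → + suc i) (upTo k)

allVecs : {A : Set} → List A → (N : ℕ) → List (Vec A N)
allVecs xs zero    = [] ∷ []
allVecs xs (suc N) = concatMap (λ x → map (x ∷_) (allVecs xs N)) xs

ProperAt : {N : ℕ} → Vec ℤ N → Fin N × Fin N × Sign → Set
ProperAt c (x , y , s) = ¬ (lookup c y ≡ act s (lookup c x))

Proper : (G : SignedGraph) → Vec ℤ (N G) → Set
Proper G c = All (ProperAt c) (edges G)

-- χᵇ G k  =  χ^b_G(2k) : number of proper zero-free signed colorings in 2k colors
χᵇ : SignedGraph → ℕ → ℕ
χᵇ G k = length (filter (λ c → all? (λ e → ¬? (lookup c (proj₁ e) ℤ.≟ act (proj₂ (proj₂ e)) (lookup c (proj₁ (proj₂ e))))) (edges G))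
                        (allVecs (colors k) (N G)))
  where open import Data.Product using (proj₁; proj₂)

-- Book graphs.  Vertices of B(m,n) are Fin (2 + n * (m ∸ 2)):
--   u = 0, v = 1, u_j^l = 2 + combine (l-1) (j-1)   (l, j 1-based in the paper,
--   0-based Fin here).

bookV : ℕ → ℕ → ℕ
bookV m n = 2 ℕ.+ n ℕ.* (m ∸ 2)

vu : (m n : ℕ) → Fin (bookV m n)
vu m n = zero

vv : (m n : ℕ) → Fin (bookV m n)
vv m n = suc zero

vin : (m n : ℕ) → Fin n → Fin (m ∸ 2) → Fin (bookV m n)
vin m n l j = suc (suc (combine l j))

-- sign of the edge u u_1^{l'+1} (l' 0-based) in B_l^*: negative iff l'+1 ≤ l-1, i.e. l'+1 < l
firstSign : ℕ → ℕ → Sign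
firstSign l l' = if suc l' <ᵇ l then neg else pos

-- the edges of the l'-th page (path u u_1 … u_{m-2} v), except uv
pageEdges : (m n : ℕ) (l : ℕ) → Fin n → List (Fin (bookV m n) × Fin (bookV m n) × Sign)
pageEdges m n l l' = go (m ∸ 2) (λ j → vin m n l' j)
  where
  go : (p : ℕ) → (Fin p → Fin (bookV m n)) → List (Fin (bookV m n) × Fin (bookV m n) × Sign)
  go zero    w = []
  go (suc q) w = (vu m n , w zero , firstSign l (toℕ l'))
               ∷ (w (fromℕ q) , vv m n , pos)
               ∷ map (λ j → (w (inject₁ j) , w (suc j) , pos)) (allFin q)

-- B_l^*(m,n): B(m,n) with signature {uv, uu_1^1, …, uu_1^{l-1}}
BookStar : (m n l : ℕ) → SignedGraph
BookStar m n l = mkSG (bookV m n) ((vu m n , vv m n , neg) ∷ concatMap (pageEdges m n l) (allFin n))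

bookFactor : ℕ → ℕ → ℤ
bookFactor m k = foldr ℤ._+_ (+ 0) (map (λ i → ((ℤ.- ℤ.1ℤ) ℤ.^ i) ℤ.* ((+ (2 ℕ.* k ∸ 1)) ℤ.^ ((m ∸ 2) ∸ i))) (upTo (suc (m ∸ 2))))

module Submission where

-- Write a colouring of B*_l(m,n) as (a, b, w): a = c(u), b = c(v),
-- and w the colours of the inner vertices, grouped into n pages of p = m-2
-- vertices each.  The edge uv is proper iff a ≠ -b, and the remaining edges
-- only constrain one page at a time, so for fixed (a, b) the number of proper
-- colourings is a product over the pages (`χᵇ-BookStar`).  A page whose edge
-- uu₁ is negative is properly coloured iff -a, x₁, …, x_p, b is a walk in the
-- complete graph on the 2k colours, i.e. no two consecutive entries coincide.
-- Counting such walks (`walks-closed`) shows that, as soon as -a ≠ b, their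
-- number is diffWalks (2k-1) p, independent of a and b.  Since l ≥ 2 the first
-- page of B*_l(m,n) is negative and the remaining n-1 pages form exactly the
-- pages of B*_{l-1}(m,n-1); hence the first page factors out of the sum over
-- (a, b) (`χᵇ-peel`).  Finally diffWalks r p equals the alternating sum
-- Σᵢ (-1)ⁱ r^(p-i) (`alternatingSum≡diffWalks`), which is the paper's factor.

module BookColourings where

  open import Defs
  open import Data.Bool using (Bool; true; false; _∧_; not; if_then_else_)
  open import Data.Bool.Properties using (∧-assoc; ∧-comm; ∧-identityʳ; ∧-zeroʳ; ∧-inverseˡ)
  open import Data.Fin using (Fin; zero; suc; toℕ; inject₁; fromℕ; combine)
  open import Data.Integer as ℤ using (ℤ; -[1+_]; -_)
  import Data.Integer.Properties as ℤ
  open import Data.List using (List; []; _∷_; _++_; map; concatMap; length; filter; upTo; allFin; foldr; tabulate)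
  open import Data.Bool.ListAction using (all; and)
  open import Data.Nat.ListAction using (product)
  open import Data.List.Properties using (map-tabulate; tabulate-cong; map-upTo; map-applyUpTo; length-++; length-map; length-upTo)
  open import Data.List.Relation.Unary.All using (All; []; _∷_; all?)
  open import Data.List.Relation.Unary.All.Properties using (++⁺; map⁺; applyUpTo⁺₁)
  open import Data.Nat using (ℕ; zero; suc; _+_; _*_; _∸_; _^_; _≤_; _<_; _≡ᵇ_; z≤n; s≤s)
  open import Data.Nat.Properties using (+-suc; +-assoc; +-comm; +-identityʳ; *-comm; *-zeroʳ; *-distribˡ-+; suc-injective; ≤-trans; +-commutativeSemigroup; m≤n+m; m+n∸n≡m)
  open import Algebra.Properties.CommutativeSemigroup +-commutativeSemigroup
    using () renaming (interchange to +-interchange; x∙yz≈y∙xz to +-swap)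
  open import Data.Vec as Vec using (Vec; lookup)
  open import Data.Vec.Properties using (lookup-++ˡ; lookup-++ʳ; tabulate∘lookup)
  import Data.Vec.Properties as VecP
  open import Data.Empty using (⊥-elim)
  open import Data.Product using (_×_; _,_)
  open import Function using (_∘_; id)
  open import Relation.Binary.Definitions using (DecidableEquality)
  open import Relation.Binary.PropositionalEquality
  open import Relation.Nullary using (Dec; does; yes; no)

  private
    variable
      A B : Set

  sumBy : (A → ℕ) → List A → ℕ
  sumBy f []       = 0
  sumBy f (x ∷ xs) = f x + sumBy f xs

  sumBy-++ : (f : A → ℕ) (xs ys : List A) → sumBy f (xs ++ ys) ≡ sumBy f xs + sumBy f ys
  sumBy-++ f []       ys = refl
  sumBy-++ f (x ∷ xs) ys = trans (cong (f x +_) (sumBy-++ f xs ys)) (sym (+-assoc (f x) _ _))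

  sumBy-map : (f : B → ℕ) (g : A → B) (xs : List A) → sumBy f (map g xs) ≡ sumBy (f ∘ g) xs
  sumBy-map f g []       = refl
  sumBy-map f g (x ∷ xs) = cong (f (g x) +_) (sumBy-map f g xs)

  sumBy-concatMap : (f : B → ℕ) (g : A → List B) (xs : List A) →
                    sumBy f (concatMap g xs) ≡ sumBy (sumBy f ∘ g) xs
  sumBy-concatMap f g []       = refl
  sumBy-concatMap f g (x ∷ xs) =
    trans (sumBy-++ f (g x) (concatMap g xs)) (cong (sumBy f (g x) +_) (sumBy-concatMap f g xs))

  sumBy-cong : {f g : A → ℕ} → (∀ x → f x ≡ g x) → (xs : List A) → sumBy f xs ≡ sumBy g xs
  sumBy-cong f≗g []       = refl
  sumBy-cong f≗g (x ∷ xs) = cong₂ _+_ (f≗g x) (sumBy-cong f≗g xs)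

  sumBy-congᴾ : {P : A → Set} {f g : A → ℕ} {xs : List A} →
                All P xs → (∀ x → P x → f x ≡ g x) → sumBy f xs ≡ sumBy g xs
  sumBy-congᴾ []         f≗g = refl
  sumBy-congᴾ (px ∷ pxs) f≗g = cong₂ _+_ (f≗g _ px) (sumBy-congᴾ pxs f≗g)

  sumBy-*ˡ : (c : ℕ) (f : A → ℕ) (xs : List A) → sumBy (λ x → c * f x) xs ≡ c * sumBy f xs
  sumBy-*ˡ c f []       = sym (*-zeroʳ c)
  sumBy-*ˡ c f (x ∷ xs) = trans (cong (c * f x +_) (sumBy-*ˡ c f xs)) (sym (*-distribˡ-+ c (f x) _))

  sumBy-*ʳ : (c : ℕ) (f : A → ℕ) (xs : List A) → sumBy (λ x → f x * c) xs ≡ sumBy f xs * c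
  sumBy-*ʳ c f xs = trans (sumBy-cong (λ x → *-comm (f x) c) xs) (trans (sumBy-*ˡ c f xs) (*-comm c _))

  sumBy-+ : (f g : A → ℕ) (xs : List A) → sumBy (λ x → f x + g x) xs ≡ sumBy f xs + sumBy g xs
  sumBy-+ f g []       = refl
  sumBy-+ f g (x ∷ xs) = trans (cong (f x + g x +_) (sumBy-+ f g xs)) (+-interchange (f x) (g x) _ _)

  ⟦_⟧ : Bool → ℕ
  ⟦ true  ⟧ = 1
  ⟦ false ⟧ = 0

  count : (A → Bool) → List A → ℕ
  count f = sumBy (λ x → ⟦ f x ⟧)

  count-none : {f : A → Bool} → (∀ x → f x ≡ false) → (xs : List A) → count f xs ≡ 0
  count-none f≡false []       = refl
  count-none f≡false (x ∷ xs) rewrite f≡false x = count-none f≡false xs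

  count-∧ : (b : Bool) (g : A → Bool) (xs : List A) → count (λ x → b ∧ g x) xs ≡ ⟦ b ⟧ * count g xs
  count-∧ true  g xs = sym (+-identityʳ _)
  count-∧ false g xs = count-none (λ _ → refl) xs

  count-complement : (f : A → Bool) (xs : List A) → count f xs + count (not ∘ f) xs ≡ length xs
  count-complement f []       = refl
  count-complement f (x ∷ xs) with f x
  ... | true  = cong suc (count-complement f xs)
  ... | false = trans (+-suc _ _) (cong suc (count-complement f xs))

  count-split : (f g : A → Bool) (xs : List A) →
                count (λ x → f x ∧ g x) xs + count (λ x → f x ∧ not (g x)) xs ≡ count f xs
  count-split f g []       = refl
  count-split f g (x ∷ xs) with f x | g x
  ... | true  | true  = cong suc (count-split f g xs)
  ... | true  | false = trans (+-suc _ _) (cong suc (count-split f g xs))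
  ... | false | _     = count-split f g xs

  split-if : (u e : Bool) (S D : ℕ) →
             ⟦ u ⟧ * (if e then S else D) ≡ ⟦ u ∧ e ⟧ * S + ⟦ u ∧ not e ⟧ * D
  split-if true  true  S D = sym (+-identityʳ (S + 0))
  split-if true  false S D = refl
  split-if false e     S D = refl

  does-⇔ : {P Q : Set} → (P → Q) → (Q → P) → (p : Dec P) (q : Dec Q) → does p ≡ does q
  does-⇔ P→Q Q→P (yes p) (yes q) = refl
  does-⇔ P→Q Q→P (yes p) (no ¬q) = ⊥-elim (¬q (P→Q p))
  does-⇔ P→Q Q→P (no ¬p) (yes q) = ⊥-elim (¬p (Q→P q))
  does-⇔ P→Q Q→P (no ¬p) (no ¬q) = refl

  -- χᵇ is phrased with `filter` and `all?`; these two lemmas turn it into a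
  -- count of a Boolean test.
  length-filter : {P : A → Set} (P? : ∀ x → Dec (P x)) (xs : List A) →
                  length (filter P? xs) ≡ count (λ x → does (P? x)) xs
  length-filter P? []       = refl
  length-filter P? (x ∷ xs) with does (P? x)
  ... | true  = cong suc (length-filter P? xs)
  ... | false = length-filter P? xs

  does-all? : {P : A → Set} (P? : ∀ x → Dec (P x)) (xs : List A) →
              does (all? P? xs) ≡ all (λ x → does (P? x)) xs
  does-all? P? []       = refl
  does-all? P? (x ∷ xs) = cong (does (P? x) ∧_) (does-all? P? xs)

  all-++ : (f : A → Bool) (xs ys : List A) → all f (xs ++ ys) ≡ all f xs ∧ all f ys
  all-++ f []       ys = refl
  all-++ f (x ∷ xs) ys = trans (cong (f x ∧_) (all-++ f xs ys)) (sym (∧-assoc (f x) _ _))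

  all-concatMap : (f : B → Bool) (g : A → List B) (xs : List A) →
                  all f (concatMap g xs) ≡ all (all f ∘ g) xs
  all-concatMap f g []       = refl
  all-concatMap f g (x ∷ xs) =
    trans (all-++ f (g x) (concatMap g xs)) (cong (all f (g x) ∧_) (all-concatMap f g xs))

  all-tabulate : (f : A → Bool) {n : ℕ} (e : Fin n → A) → all f (tabulate e) ≡ and (tabulate (f ∘ e))
  all-tabulate f e = cong and (map-tabulate e f)

  sumBy-allVecs-suc : (Cs : List A) (N : ℕ) (F : Vec A (suc N) → ℕ) →
    sumBy F (allVecs Cs (suc N)) ≡ sumBy (λ x → sumBy (F ∘ (x Vec.∷_)) (allVecs Cs N)) Cs
  sumBy-allVecs-suc Cs N F =
    trans (sumBy-concatMap F _ Cs) (sumBy-cong (λ x → sumBy-map F (x Vec.∷_) (allVecs Cs N)) Cs)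

  sumBy-allVecs-++ : {A : Set} (Cs : List A) (p r : ℕ) (F : Vec A (p + r) → ℕ) →
    sumBy F (allVecs Cs (p + r)) ≡ sumBy (λ x → sumBy (λ y → F (x Vec.++ y)) (allVecs Cs r)) (allVecs Cs p)
  sumBy-allVecs-++ Cs zero    r F = sym (+-identityʳ _)
  sumBy-allVecs-++ {A} Cs (suc p) r F = begin
      sumBy F (allVecs Cs (suc p + r))
    ≡⟨ sumBy-allVecs-suc Cs (p + r) F ⟩
      sumBy (λ a → sumBy (F ∘ (a Vec.∷_)) (allVecs Cs (p + r))) Cs
    ≡⟨ sumBy-cong (λ a → sumBy-allVecs-++ Cs p r (F ∘ (a Vec.∷_))) Cs ⟩
      sumBy (λ a → sumBy (G ∘ (a Vec.∷_)) (allVecs Cs p)) Cs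
    ≡⟨ sym (sumBy-allVecs-suc Cs p G) ⟩
      sumBy G (allVecs Cs (suc p)) ∎
    where
    open ≡-Reasoning
    G : Vec A (suc p) → ℕ
    G x = sumBy (λ y → F (x Vec.++ y)) (allVecs Cs r)

  block : (n p : ℕ) → Fin n → Vec A (n * p) → Vec A p
  block n p l w = Vec.tabulate (λ j → lookup w (combine l j))

  block-zero : (n p : ℕ) (x : Vec A p) (y : Vec A (n * p)) → block (suc n) p zero (x Vec.++ y) ≡ x
  block-zero n p x y = trans (VecP.tabulate-cong (lookup-++ˡ x y)) (tabulate∘lookup x)

  block-suc : (n p : ℕ) (l : Fin n) (x : Vec A p) (y : Vec A (n * p)) →
              block (suc n) p (suc l) (x Vec.++ y) ≡ block n p l y
  block-suc n p l x y = VecP.tabulate-cong (λ j → lookup-++ʳ x y (combine l j))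

  count-blocks : {A : Set} (Cs : List A) (n p : ℕ) (P : Fin n → Vec A p → Bool) →
    count (λ w → and (tabulate (λ l → P l (block n p l w)))) (allVecs Cs (n * p))
      ≡ product (tabulate (λ l → count (P l) (allVecs Cs p)))
  count-blocks Cs zero    p P = refl
  count-blocks {A} Cs (suc n) p P = begin
      count (λ w → and (tabulate (λ l → P l (block (suc n) p l w)))) (allVecs Cs (p + n * p))
    ≡⟨ sumBy-allVecs-++ Cs p (n * p) _ ⟩
      sumBy (λ x → count (λ y → and (tabulate (λ l → P l (block (suc n) p l (x Vec.++ y))))) (allVecs Cs (n * p)))
            (allVecs Cs p)
    ≡⟨ sumBy-cong (λ x → trans (sumBy-cong (λ y → cong ⟦_⟧ (split x y)) (allVecs Cs (n * p)))
                                (count-∧ (P zero x) rest (allVecs Cs (n * p)))) (allVecs Cs p) ⟩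
      sumBy (λ x → ⟦ P zero x ⟧ * count rest (allVecs Cs (n * p))) (allVecs Cs p)
    ≡⟨ sumBy-*ʳ _ (λ x → ⟦ P zero x ⟧) (allVecs Cs p) ⟩
      count (P zero) (allVecs Cs p) * count rest (allVecs Cs (n * p))
    ≡⟨ cong (count (P zero) (allVecs Cs p) *_) (count-blocks Cs n p (P ∘ suc)) ⟩
      product (tabulate (λ l → count (P l) (allVecs Cs p))) ∎
    where
    open ≡-Reasoning
    rest : Vec A (n * p) → Bool
    rest y = and (tabulate (λ l → P (suc l) (block n p l y)))
    split : ∀ x y → and (tabulate (λ l → P l (block (suc n) p l (x Vec.++ y)))) ≡ P zero x ∧ rest y
    split x y = cong₂ (λ u v → P zero u ∧ v) (block-zero n p x y)
                      (cong and (tabulate-cong (λ l → cong (P (suc l)) (block-suc n p l x y))))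

  -- With L inner vertices in a complete graph on r + 1 vertices, sameWalks r L
  -- and diffWalks r L count the walks between equal and between distinct
  -- endpoints: the first step leaves a for one of its r neighbours.
  sameWalks diffWalks : ℕ → ℕ → ℕ
  sameWalks r zero    = 0
  sameWalks r (suc L) = r * diffWalks r L
  diffWalks r zero    = 1
  diffWalks r (suc L) = sameWalks r L + (r ∸ 1) * diffWalks r L

  module CompleteGraphWalks {A : Set} (_≟_ : DecidableEquality A) where

    infix 4 _==_
    _==_ : A → A → Bool
    x == y = does (x ≟ y)

    ==⇒≡ : {x y : A} → (x == y) ≡ true → x ≡ y
    ==⇒≡ {x} {y} x==y with x ≟ y
    ... | yes x≡y = x≡y

    ==-sym : (x y : A) → (x == y) ≡ (y == x)
    ==-sym x y = does-⇔ sym sym (x ≟ y) (y ≟ x)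

    walk : {L : ℕ} → A → Vec A L → A → Bool
    walk a Vec.[]       b = not (a == b)
    walk a (x Vec.∷ xs) b = not (a == x) ∧ walk x xs b

    -- The walk condition on a tabulated vector, with the last step checked first
    -- (the order in which the edges of a page of a book graph are listed).
    walk-tabulate : (q : ℕ) (y : Fin (suc q) → A) (b : A) →
      not (y (fromℕ q) == b) ∧ and (tabulate (λ j → not (y (inject₁ j) == y (suc j))))
        ≡ walk (y zero) (Vec.tabulate (y ∘ suc)) b
    walk-tabulate zero    y b = ∧-identityʳ _
    walk-tabulate (suc q) y b = begin
        last ∧ (first ∧ middle)
      ≡⟨ sym (∧-assoc last first middle) ⟩
        (last ∧ first) ∧ middle
      ≡⟨ cong (_∧ middle) (∧-comm last first) ⟩
        (first ∧ last) ∧ middle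
      ≡⟨ ∧-assoc first last middle ⟩
        first ∧ (last ∧ middle)
      ≡⟨ cong (first ∧_) (walk-tabulate q (y ∘ suc) b) ⟩
        first ∧ walk (y (suc zero)) (Vec.tabulate (λ j → y (suc (suc j)))) b ∎
      where
      open ≡-Reasoning
      last first middle : Bool
      last   = not (y (fromℕ (suc q)) == b)
      first  = not (y zero == y (suc zero))
      middle = and (tabulate (λ j → not (y (inject₁ (suc j)) == y (suc (suc j)))))

    walks : List A → ℕ → A → A → ℕ
    walks Cs L a b = count (λ xs → walk a xs b) (allVecs Cs L)

    walks-suc : (Cs : List A) (L : ℕ) (a b : A) →
                walks Cs (suc L) a b ≡ sumBy (λ x → ⟦ not (a == x) ⟧ * walks Cs L x b) Cs
    walks-suc Cs L a b = trans (sumBy-allVecs-suc Cs L _)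
      (sumBy-cong (λ x → count-∧ (not (a == x)) (λ xs → walk x xs b) (allVecs Cs L)) Cs)

    Simple : List A → A → Set
    Simple Cs c = count (_== c) Cs ≡ 1

    -- Cs is the vertex list of a complete graph on r + 1 vertices.
    module _ (Cs : List A) (r : ℕ) (|Cs|≡1+r : length Cs ≡ suc r) (allSimple : All (Simple Cs) Cs) where

      count-≢ : (b : A) → Simple Cs b → count (λ x → not (x == b)) Cs ≡ r
      count-≢ b simple-b = suc-injective (begin
          suc (count (λ x → not (x == b)) Cs)
        ≡⟨ cong (_+ count (λ x → not (x == b)) Cs) (sym simple-b) ⟩
          count (_== b) Cs + count (λ x → not (x == b)) Cs
        ≡⟨ count-complement (_== b) Cs ⟩
          length Cs
        ≡⟨ |Cs|≡1+r ⟩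
          suc r ∎)
        where open ≡-Reasoning

      -- The neighbours x of a split into x = b and x ∉ {a, b}; this gives the
      -- recursion defining sameWalks and diffWalks.
      neighbour-split : (a b : A) → Simple Cs a → Simple Cs b → (S D : ℕ) →
        count (λ x → not (a == x) ∧ (x == b)) Cs * S + count (λ x → not (a == x) ∧ not (x == b)) Cs * D
          ≡ (if a == b then r * D else S + (r ∸ 1) * D)
      neighbour-split a b simple-a simple-b S D = by-cases (a == b) refl
        where
        open ≡-Reasoning
        toB avoid : ℕ
        toB   = count (λ x → not (a == x) ∧ (x == b)) Cs
        avoid = count (λ x → not (a == x) ∧ not (x == b)) Cs

        both : toB + avoid ≡ r
        both = trans (count-split (λ x → not (a == x)) (_== b) Cs)
                     (trans (sumBy-cong (λ x → cong (λ t → ⟦ not t ⟧) (==-sym a x)) Cs) (count-≢ a simple-a))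

        by-cases : (t : Bool) → (a == b) ≡ t →
                   toB * S + avoid * D ≡ (if t then r * D else S + (r ∸ 1) * D)
        by-cases true a==b = begin
            toB * S + avoid * D ≡⟨ cong (λ t → t * S + avoid * D) toB≡0 ⟩
            avoid * D           ≡⟨ cong (_* D) (trans (cong (_+ avoid) (sym toB≡0)) both) ⟩
            r * D               ∎
          where
          toB≡0 : toB ≡ 0
          toB≡0 = count-none (λ x → trans (cong (λ t → not t ∧ (x == b)) (trans (cong (_== x) (==⇒≡ a==b)) (==-sym b x)))
                                          (∧-inverseˡ (x == b))) Cs
        by-cases false a≠b = begin
            toB * S + avoid * D ≡⟨ cong (λ t → t * S + avoid * D) toB≡1 ⟩
            S + 0 + avoid * D   ≡⟨ cong₂ (λ u v → u + v * D) (+-identityʳ S) avoid≡r-1 ⟩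
            S + (r ∸ 1) * D     ∎
          where
          only-b : (x : A) → (not (a == x) ∧ (x == b)) ≡ (x == b)
          only-b x with x == b in x==b
          ... | false = ∧-zeroʳ _
          ... | true  = cong (λ t → not t ∧ true) (trans (cong (a ==_) (==⇒≡ x==b)) a≠b)
          toB≡1 : toB ≡ 1
          toB≡1 = trans (sumBy-cong (λ x → cong ⟦_⟧ (only-b x)) Cs) simple-b
          avoid≡r-1 : avoid ≡ r ∸ 1
          avoid≡r-1 = cong (_∸ 1) (trans (cong (_+ avoid) (sym toB≡1)) both)

      walks-closed : (L : ℕ) (a b : A) → Simple Cs a → Simple Cs b →
                     walks Cs L a b ≡ (if a == b then sameWalks r L else diffWalks r L)
      walks-closed zero a b _ _ with a == b
      ... | true  = refl
      ... | false = refl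
      walks-closed (suc L) a b simple-a simple-b = begin
          walks Cs (suc L) a b
        ≡⟨ walks-suc Cs L a b ⟩
          sumBy (λ x → ⟦ not (a == x) ⟧ * walks Cs L x b) Cs
        ≡⟨ sumBy-congᴾ allSimple (λ x simple-x → cong (⟦ not (a == x) ⟧ *_) (walks-closed L x b simple-x simple-b)) ⟩
          sumBy (λ x → ⟦ not (a == x) ⟧ * (if x == b then S else D)) Cs
        ≡⟨ sumBy-cong (λ x → split-if (not (a == x)) (x == b) S D) Cs ⟩
          sumBy (λ x → ⟦ not (a == x) ∧ (x == b) ⟧ * S + ⟦ not (a == x) ∧ not (x == b) ⟧ * D) Cs
        ≡⟨ sumBy-+ (λ x → ⟦ not (a == x) ∧ (x == b) ⟧ * S) (λ x → ⟦ not (a == x) ∧ not (x == b) ⟧ * D) Cs ⟩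
          sumBy (λ x → ⟦ not (a == x) ∧ (x == b) ⟧ * S) Cs + sumBy (λ x → ⟦ not (a == x) ∧ not (x == b) ⟧ * D) Cs
        ≡⟨ cong₂ _+_ (sumBy-*ʳ S (λ x → ⟦ not (a == x) ∧ (x == b) ⟧) Cs)
                     (sumBy-*ʳ D (λ x → ⟦ not (a == x) ∧ not (x == b) ⟧) Cs) ⟩
          count (λ x → not (a == x) ∧ (x == b)) Cs * S + count (λ x → not (a == x) ∧ not (x == b)) Cs * D
        ≡⟨ neighbour-split a b simple-a simple-b S D ⟩
          (if a == b then sameWalks r (suc L) else diffWalks r (suc L)) ∎
        where
        open ≡-Reasoning
        S D : ℕ
        S = sameWalks r L
        D = diffWalks r L

  open CompleteGraphWalks ℤ._≟_

  ==-flip : (a x : ℤ) → (a == - x) ≡ (- a == x)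
  ==-flip a x = does-⇔ (λ a≡-x → trans (cong -_ a≡-x) (ℤ.neg-involutive x))
                       (λ -a≡x → trans (sym (ℤ.neg-involutive a)) (cong -_ -a≡x))
                       (a ℤ.≟ - x) (- a ℤ.≟ x)

  count-upTo-suc : (f : ℕ → Bool) (k : ℕ) → count f (upTo (suc k)) ≡ ⟦ f 0 ⟧ + count (f ∘ suc) (upTo k)
  count-upTo-suc f k = cong (⟦ f 0 ⟧ +_) (trans (cong (count f) (sym (map-upTo suc k))) (sumBy-map _ suc (upTo k)))

  count-upTo : {i k : ℕ} → i < k → count (_≡ᵇ i) (upTo k) ≡ 1
  count-upTo {zero}  {suc k} _         = trans (count-upTo-suc (_≡ᵇ 0) k) (cong suc (count-none (λ _ → refl) (upTo k)))
  count-upTo {suc i} {suc k} (s≤s i<k) = trans (count-upTo-suc (_≡ᵇ suc i) k) (count-upTo i<k)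

  count-colors : (f : ℤ → Bool) (k : ℕ) →
                 count f (colors k) ≡ count (f ∘ -[1+_]) (upTo k) + count (λ i → f (ℤ.+ suc i)) (upTo k)
  count-colors f k = trans (sumBy-++ _ (map -[1+_] (upTo k)) _)
                           (cong₂ _+_ (sumBy-map _ -[1+_] (upTo k)) (sumBy-map _ (λ i → ℤ.+ suc i) (upTo k)))

  -- There are 2k colours, so k ≥ 1 gives a complete graph on r + 1 = 2k vertices.
  length-colors : (k : ℕ) → length (colors k) ≡ 2 * k
  length-colors k = trans (length-++ (map -[1+_] (upTo k)))
    (cong₂ _+_ (trans (length-map -[1+_] (upTo k)) (length-upTo k))
               (trans (trans (length-map (λ i → ℤ.+ suc i) (upTo k)) (length-upTo k)) (sym (+-identityʳ k))))

  colors-simple : (k : ℕ) → All (Simple (colors k)) (colors k)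
  colors-simple k = ++⁺ (map⁺ (applyUpTo⁺₁ id k negative)) (map⁺ (applyUpTo⁺₁ id k positive))
    where
    negative : {i : ℕ} → i < k → Simple (colors k) -[1+ i ]
    negative i<k = trans (count-colors _ k) (cong₂ _+_ (count-upTo i<k) (count-none (λ _ → refl) (upTo k)))
    positive : {i : ℕ} → i < k → Simple (colors k) (ℤ.+ suc i)
    positive i<k = trans (count-colors _ k) (cong₂ _+_ (count-none (λ _ → refl) (upTo k)) (count-upTo i<k))

  simple-neg : (k : ℕ) (c : ℤ) → Simple (colors k) c → Simple (colors k) (- c)
  simple-neg k c simple-c = begin
      count (_== - c) (colors k)
    ≡⟨ count-colors (_== - c) k ⟩
      count (λ i → -[1+ i ] == - c) (upTo k) + count (λ i → ℤ.+ suc i == - c) (upTo k)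
    ≡⟨ cong₂ _+_ (sumBy-cong (λ i → cong ⟦_⟧ (==-flip -[1+ i ] c)) (upTo k))
                 (sumBy-cong (λ i → cong ⟦_⟧ (==-flip (ℤ.+ suc i) c)) (upTo k)) ⟩
      count (λ i → ℤ.+ suc i == c) (upTo k) + count (λ i → -[1+ i ] == c) (upTo k)
    ≡⟨ +-comm (count (λ i → ℤ.+ suc i == c) (upTo k)) _ ⟩
      count (λ i → -[1+ i ] == c) (upTo k) + count (λ i → ℤ.+ suc i == c) (upTo k)
    ≡⟨ sym (count-colors (_== c) k) ⟩
      count (_== c) (colors k)
    ≡⟨ simple-c ⟩
      1 ∎
    where open ≡-Reasoning

  edgeOK : {N : ℕ} → Vec ℤ N → Fin N × Fin N × Sign → Bool
  edgeOK c (x , y , s) = not (lookup c x == act s (lookup c y))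

  χᵇ-count : (G : SignedGraph) (k : ℕ) →
             χᵇ G k ≡ count (λ c → all (edgeOK c) (edges G)) (allVecs (colors k) (N G))
  χᵇ-count G k = trans (length-filter _ (allVecs (colors k) (N G)))
                       (sumBy-cong (λ c → cong ⟦_⟧ (does-all? _ (edges G))) (allVecs (colors k) (N G)))

  -- A page with inner colours x₀ … x_q, whose edge u x₀ has sign s, is properly
  -- coloured when c(u) = a and c(v) = b.
  pageOK : {q : ℕ} → Sign → ℤ → ℤ → Vec ℤ (suc q) → Bool
  pageOK s a b (x Vec.∷ xs) = not (a == act s x) ∧ walk x xs b

  pageEdges-OK : (q n l : ℕ) (l' : Fin n) (a b : ℤ) (w : Vec ℤ (n * suc q)) →
    all (edgeOK (a Vec.∷ b Vec.∷ w)) (pageEdges (3 + q) n l l')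
      ≡ pageOK (firstSign l (toℕ l')) a b (block n (suc q) l' w)
  pageEdges-OK q n l l' a b w =
    cong (not (a == act (firstSign l (toℕ l')) (y zero)) ∧_)
         (trans (cong (not (y (fromℕ q) == b) ∧_) inner-path) (walk-tabulate q y b))
    where
    y : Fin (suc q) → ℤ
    y j = lookup w (combine l' j)
    inner-edge : Fin q → Fin (bookV (3 + q) n) × Fin (bookV (3 + q) n) × Sign
    inner-edge j = vin (3 + q) n l' (inject₁ j) , vin (3 + q) n l' (suc j) , pos
    inner-path : all (edgeOK (a Vec.∷ b Vec.∷ w)) (map inner-edge (allFin q))
                   ≡ and (tabulate (λ j → not (y (inject₁ j) == y (suc j))))
    inner-path = trans (cong (all (edgeOK (a Vec.∷ b Vec.∷ w))) (map-tabulate id inner-edge))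
                       (all-tabulate (edgeOK (a Vec.∷ b Vec.∷ w)) inner-edge)

  pageCount : (k q : ℕ) → Sign → ℤ → ℤ → ℕ
  pageCount k q s a b = count (pageOK s a b) (allVecs (colors k) (suc q))

  pagesCount : (k q n l : ℕ) → ℤ → ℤ → ℕ
  pagesCount k q n l a b = product (tabulate (λ (l' : Fin n) → pageCount k q (firstSign l (toℕ l')) a b))

  -- χᵇ of a book graph: sum over the colours a, b of u and v; the edge uv and
  -- the n pages then impose independent conditions.
  χᵇ-BookStar : (q n l k : ℕ) → χᵇ (BookStar (3 + q) n l) k
    ≡ sumBy (λ a → sumBy (λ b → ⟦ not (a == - b) ⟧ * pagesCount k q n l a b) (colors k)) (colors k)
  χᵇ-BookStar q n l k = begin
      χᵇ (BookStar (3 + q) n l) k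
    ≡⟨ χᵇ-count (BookStar (3 + q) n l) k ⟩
      count proper (allVecs Cs (2 + n * suc q))
    ≡⟨ sumBy-allVecs-suc Cs _ (λ c → ⟦ proper c ⟧) ⟩
      sumBy (λ a → count (proper ∘ (a Vec.∷_)) (allVecs Cs (suc (n * suc q)))) Cs
    ≡⟨ sumBy-cong (λ a → sumBy-allVecs-suc Cs _ (λ c → ⟦ proper (a Vec.∷ c) ⟧)) Cs ⟩
      sumBy (λ a → sumBy (λ b → count (λ w → proper (a Vec.∷ b Vec.∷ w)) (allVecs Cs (n * suc q))) Cs) Cs
    ≡⟨ sumBy-cong (λ a → sumBy-cong (λ b → fixed-ends a b) Cs) Cs ⟩
      sumBy (λ a → sumBy (λ b → ⟦ not (a == - b) ⟧ * pagesCount k q n l a b) Cs) Cs ∎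
    where
    open ≡-Reasoning
    Cs : List ℤ
    Cs = colors k
    proper : Vec ℤ (bookV (3 + q) n) → Bool
    proper c = all (edgeOK c) (edges (BookStar (3 + q) n l))
    sign : Fin n → Sign
    sign l' = firstSign l (toℕ l')
    pagesOK : ℤ → ℤ → Vec ℤ (n * suc q) → Bool
    pagesOK a b w = and (tabulate (λ l' → pageOK (sign l') a b (block n (suc q) l' w)))
    fixed-ends : (a b : ℤ) → count (λ w → proper (a Vec.∷ b Vec.∷ w)) (allVecs Cs (n * suc q))
                               ≡ ⟦ not (a == - b) ⟧ * pagesCount k q n l a b
    fixed-ends a b = begin
        count (λ w → proper (a Vec.∷ b Vec.∷ w)) (allVecs Cs (n * suc q))
      ≡⟨ sumBy-cong (λ w → cong (λ t → ⟦ not (a == - b) ∧ t ⟧) (pages-OK w)) (allVecs Cs (n * suc q)) ⟩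
        count (λ w → not (a == - b) ∧ pagesOK a b w) (allVecs Cs (n * suc q))
      ≡⟨ count-∧ (not (a == - b)) (pagesOK a b) (allVecs Cs (n * suc q)) ⟩
        ⟦ not (a == - b) ⟧ * count (pagesOK a b) (allVecs Cs (n * suc q))
      ≡⟨ cong (⟦ not (a == - b) ⟧ *_) (count-blocks Cs n (suc q) (λ l' → pageOK (sign l') a b)) ⟩
        ⟦ not (a == - b) ⟧ * pagesCount k q n l a b ∎
      where
      pages-OK : (w : Vec ℤ (n * suc q)) →
                 all (edgeOK (a Vec.∷ b Vec.∷ w)) (concatMap (pageEdges (3 + q) n l) (allFin n)) ≡ pagesOK a b w
      pages-OK w = trans (all-concatMap _ (pageEdges (3 + q) n l) (allFin n))
                   (trans (all-tabulate (all (edgeOK (a Vec.∷ b Vec.∷ w)) ∘ pageEdges (3 + q) n l) id) (cong and (tabulate-cong (λ l' → pageEdges-OK q n l l' a b w))))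

  -- A page with negative edge u x₀ is a walk from -a to b in the complete graph
  -- on the 2k colours; so for a ≠ -b it has diffWalks (2k-1) (q+1) proper colourings.
  pageCount-neg : (k q : ℕ) (a b : ℤ) → Simple (colors (suc k)) a → Simple (colors (suc k)) b →
                  (a == - b) ≡ false → pageCount (suc k) q neg a b ≡ diffWalks (2 * suc k ∸ 1) (suc q)
  pageCount-neg k q a b simple-a simple-b a≢-b = begin
      pageCount (suc k) q neg a b
    ≡⟨ sumBy-cong negative-page (allVecs Cs (suc q)) ⟩
      walks Cs (suc q) (- a) b
    ≡⟨ walks-closed Cs r (length-colors (suc k)) (colors-simple (suc k)) (suc q) (- a) b
                    (simple-neg (suc k) a simple-a) simple-b ⟩
      (if - a == b then sameWalks r (suc q) else diffWalks r (suc q))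
    ≡⟨ cong (λ t → if t then sameWalks r (suc q) else diffWalks r (suc q)) (trans (sym (==-flip a b)) a≢-b) ⟩
      diffWalks r (suc q) ∎
    where
    open ≡-Reasoning
    Cs : List ℤ
    Cs = colors (suc k)
    r : ℕ
    r = 2 * suc k ∸ 1
    negative-page : (xs : Vec ℤ (suc q)) → ⟦ pageOK neg a b xs ⟧ ≡ ⟦ walk (- a) xs b ⟧
    negative-page (x Vec.∷ xs) = cong (λ t → ⟦ not t ∧ walk x xs b ⟧) (==-flip a x)

  -- For l ≥ 2 the first page of B*_l(m, n+1) is negative, and its remaining
  -- pages are the pages of B*_{l-1}(m, n).
  pagesCount-first : (k q n l : ℕ) (a b : ℤ) →
                     pagesCount k q (suc n) (2 + l) a b ≡ pageCount k q neg a b * pagesCount k q n (1 + l) a b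
  pagesCount-first k q n l a b = refl

  χᵇ-peel : (q n l k : ℕ) → χᵇ (BookStar (3 + q) (suc n) (2 + l)) (suc k)
                             ≡ diffWalks (2 * suc k ∸ 1) (suc q) * χᵇ (BookStar (3 + q) n (1 + l)) (suc k)
  χᵇ-peel q n l k = begin
      χᵇ (BookStar (3 + q) (suc n) (2 + l)) (suc k)
    ≡⟨ χᵇ-BookStar q (suc n) (2 + l) (suc k) ⟩
      sumBy (λ a → sumBy (λ b → ⟦ not (a == - b) ⟧ * pagesCount (suc k) q (suc n) (2 + l) a b) Cs) Cs
    ≡⟨ sumBy-congᴾ (colors-simple (suc k)) (λ a simple-a →
         sumBy-congᴾ (colors-simple (suc k)) (λ b simple-b → first-page a b simple-a simple-b)) ⟩
      sumBy (λ a → sumBy (λ b → D * rest a b) Cs) Cs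
    ≡⟨ sumBy-cong (λ a → sumBy-*ˡ D (rest a) Cs) Cs ⟩
      sumBy (λ a → D * sumBy (rest a) Cs) Cs
    ≡⟨ sumBy-*ˡ D (λ a → sumBy (rest a) Cs) Cs ⟩
      D * sumBy (λ a → sumBy (rest a) Cs) Cs
    ≡⟨ cong (D *_) (sym (χᵇ-BookStar q n (1 + l) (suc k))) ⟩
      D * χᵇ (BookStar (3 + q) n (1 + l)) (suc k) ∎
    where
    open ≡-Reasoning
    Cs : List ℤ
    Cs = colors (suc k)
    D : ℕ
    D = diffWalks (2 * suc k ∸ 1) (suc q)
    rest : ℤ → ℤ → ℕ
    rest a b = ⟦ not (a == - b) ⟧ * pagesCount (suc k) q n (1 + l) a b
    first-page : (a b : ℤ) → Simple Cs a → Simple Cs b →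
                 ⟦ not (a == - b) ⟧ * pagesCount (suc k) q (suc n) (2 + l) a b ≡ D * rest a b
    first-page a b simple-a simple-b with a == - b in a==-b
    ... | true  = sym (*-zeroʳ D)
    ... | false = begin
        pagesCount (suc k) q (suc n) (2 + l) a b + 0
      ≡⟨ +-identityʳ _ ⟩
        pagesCount (suc k) q (suc n) (2 + l) a b
      ≡⟨ pagesCount-first (suc k) q n l a b ⟩
        pageCount (suc k) q neg a b * pagesCount (suc k) q n (1 + l) a b
      ≡⟨ cong₂ _*_ (pageCount-neg k q a b simple-a simple-b a==-b) (sym (+-identityʳ _)) ⟩
        D * (pagesCount (suc k) q n (1 + l) a b + 0) ∎

  -- Summing over all endpoints: a walk from a with L inner vertices in the
  -- complete graph on r + 1 vertices is an arbitrary sequence of L + 1 steps.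
  walks-total : (r L : ℕ) → sameWalks (suc r) L + suc r * diffWalks (suc r) L ≡ suc r ^ suc L
  walks-total r zero    = refl
  walks-total r (suc L) = begin
      R * D + R * (S + r * D)   ≡⟨ sym (*-distribˡ-+ R D (S + r * D)) ⟩
      R * (D + (S + r * D))     ≡⟨ cong (R *_) (+-swap D S (r * D)) ⟩
      R * (S + (D + r * D))     ≡⟨ cong (R *_) (walks-total r L) ⟩
      R * R ^ suc L             ∎
    where
    open ≡-Reasoning
    R S D : ℕ
    R = suc r
    S = sameWalks R L
    D = diffWalks R L

  diffWalks-step : (r L : ℕ) → diffWalks (suc r) (suc L) + diffWalks (suc r) L ≡ suc r ^ suc L
  diffWalks-step r L = begin
      S + r * D + D     ≡⟨ +-assoc S (r * D) D ⟩
      S + (r * D + D)   ≡⟨ cong (S +_) (+-comm (r * D) D) ⟩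
      S + suc r * D     ≡⟨ walks-total r L ⟩
      suc r ^ suc L     ∎
    where
    open ≡-Reasoning
    S D : ℕ
    S = sameWalks (suc r) L
    D = diffWalks (suc r) L

  sumᶻ : (ℕ → ℤ) → List ℕ → ℤ
  sumᶻ f xs = foldr ℤ._+_ (ℤ.+ 0) (map f xs)

  sumᶻ-upTo-suc : (f : ℕ → ℤ) (n : ℕ) → sumᶻ f (upTo (suc n)) ≡ f 0 ℤ.+ sumᶻ (f ∘ suc) (upTo n)
  sumᶻ-upTo-suc f n = cong (λ xs → f 0 ℤ.+ foldr ℤ._+_ (ℤ.+ 0) xs)
                           (trans (map-applyUpTo suc f n) (sym (map-upTo (f ∘ suc) n)))

  sumᶻ-negate : {f g : ℕ → ℤ} → (∀ i → g i ≡ - f i) → (xs : List ℕ) → sumᶻ g xs ≡ - sumᶻ f xs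
  sumᶻ-negate         g≡-f []       = refl
  sumᶻ-negate {f} {g} g≡-f (x ∷ xs) =
    trans (cong₂ ℤ._+_ (g≡-f x) (sumᶻ-negate g≡-f xs)) (sym (ℤ.neg-distrib-+ (f x) (sumᶻ f xs)))

  -- Σ_{i=0}^{p} (-1)^i r^(p-i); bookFactor m k is this sum for r = 2k-1, p = m-2.
  alternatingTerm : ℕ → ℕ → ℕ → ℤ
  alternatingTerm r p i = (- ℤ.1ℤ) ℤ.^ i ℤ.* (ℤ.+ r) ℤ.^ (p ∸ i)

  alternatingSum : ℕ → ℕ → ℤ
  alternatingSum r p = sumᶻ (alternatingTerm r p) (upTo (suc p))

  alternatingSum-suc : (r p : ℕ) → alternatingSum r (suc p) ≡ (ℤ.+ r) ℤ.^ suc p ℤ.+ - alternatingSum r p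
  alternatingSum-suc r p =
    trans (sumᶻ-upTo-suc (alternatingTerm r (suc p)) (suc p))
          (cong₂ ℤ._+_ (ℤ.*-identityˡ ((ℤ.+ r) ℤ.^ suc p)) (sumᶻ-negate shifted (upTo (suc p))))
    where
    shifted : (i : ℕ) → alternatingTerm r (suc p) (suc i) ≡ - alternatingTerm r p i
    shifted i = trans (ℤ.*-assoc (- ℤ.1ℤ) ((- ℤ.1ℤ) ℤ.^ i) _) (ℤ.-1*i≡-i (alternatingTerm r p i))

  pos-^ : (m n : ℕ) → ℤ.+ (m ^ n) ≡ (ℤ.+ m) ℤ.^ n
  pos-^ m zero    = refl
  pos-^ m (suc n) = trans (ℤ.pos-* m (m ^ n)) (cong (ℤ.+ m ℤ.*_) (pos-^ m n))

  alternatingSum≡diffWalks : (r p : ℕ) → 1 ≤ r → alternatingSum r p ≡ ℤ.+ diffWalks r p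
  alternatingSum≡diffWalks (suc r) zero    _ = refl
  alternatingSum≡diffWalks (suc r) (suc p) _ = begin
      alternatingSum (suc r) (suc p)
    ≡⟨ alternatingSum-suc (suc r) p ⟩
      (ℤ.+ suc r) ℤ.^ suc p ℤ.+ - alternatingSum (suc r) p
    ≡⟨ cong₂ (λ x y → x ℤ.+ - y)
             (trans (sym (pos-^ (suc r) (suc p))) (cong ℤ.+_ (sym (diffWalks-step r p))))
             (alternatingSum≡diffWalks (suc r) p (s≤s z≤n)) ⟩
      ℤ.+ (D₁ + D₀) ℤ.+ - ℤ.+ D₀
    ≡⟨ ℤ.m-n≡m⊖n (D₁ + D₀) D₀ ⟩
      (D₁ + D₀) ℤ.⊖ D₀
    ≡⟨ ℤ.⊖-≥ (m≤n+m D₀ D₁) ⟩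
      ℤ.+ (D₁ + D₀ ∸ D₀)
    ≡⟨ cong ℤ.+_ (m+n∸n≡m D₁ D₀) ⟩
      ℤ.+ D₁ ∎
    where
    open ≡-Reasoning
    D₁ D₀ : ℕ
    D₁ = diffWalks (suc r) (suc p)
    D₀ = diffWalks (suc r) p

  -- The factor of the theorem: with r = 2k - 1 ≥ 1 colours different from a given one.
  bookFactor≡diffWalks : (q k : ℕ) → bookFactor (3 + q) (suc k) ≡ ℤ.+ diffWalks (2 * suc k ∸ 1) (suc q)
  bookFactor≡diffWalks q k = alternatingSum≡diffWalks (2 * suc k ∸ 1) (suc q) (≤-trans (s≤s z≤n) (m≤n+m (1 * suc k) k))

open BookColourings using (diffWalks; χᵇ-peel; bookFactor≡diffWalks)
open import Defs
open import Data.Nat as ℕ using (ℕ; _≤_; _∸_; ⌈_/2⌉; suc; z≤n; s≤s)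
open import Data.Integer using (+_; _*_)
open import Data.Integer.Properties using (pos-*)
open import Relation.Binary.PropositionalEquality using (_≡_; cong; sym; module ≡-Reasoning)

-- Write m = q + 3, n = n' + 1, l = l' + 2 and k = k' + 1: peel off the first page and identify its factor with bookFactor.
theorem7p9 : (m n l k : ℕ) → 3 ≤ m → 2 ≤ n → 2 ≤ l → l ≤ ⌈ n /2⌉ → 1 ≤ k →
    + χᵇ (BookStar m n l) k ≡ bookFactor m k * + χᵇ (BookStar m (n ∸ 1) (l ∸ 1)) k
theorem7p9 m@(suc (suc (suc q))) n@(suc n') l@(suc (suc l')) k@(suc k')
           (s≤s (s≤s (s≤s z≤n))) (s≤s _) (s≤s (s≤s z≤n)) _ (s≤s z≤n) = begin
    + χᵇ (BookStar m n l) k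
  ≡⟨ cong +_ (χᵇ-peel q n' l' k') ⟩
    + (D ℕ.* χᵇ (BookStar m (n ∸ 1) (l ∸ 1)) k)
  ≡⟨ pos-* D (χᵇ (BookStar m (n ∸ 1) (l ∸ 1)) k) ⟩
    + D * + χᵇ (BookStar m (n ∸ 1) (l ∸ 1)) k
  ≡⟨ cong (_* + χᵇ (BookStar m (n ∸ 1) (l ∸ 1)) k) (sym (bookFactor≡diffWalks q k')) ⟩
    bookFactor m k * + χᵇ (BookStar m (n ∸ 1) (l ∸ 1)) k ∎
  where
  open ≡-Reasoning
  D : ℕ
  D = diffWalks (2 ℕ.* k ∸ 1) (m ∸ 2)
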